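{- Suppose a streaming algorithm $\mathbf{ALG}$ uses $c$ bits of memory and distinguishes the $\mathbf{Y}$ and $\mathbf{N}$ distributions (with $k$ stages) with advantage $1/4$. Then $\mathbf{ALG}$ has an $\Omega(1/k)$-informative index, where the constant in $\Omega$ is absolute.
   Context: Both distributions (parameters $p\ge2$, $n$, $k$, $\alpha$ with $\alpha n$ integer): sample $k$ independent uniformly random $\alpha$-partial matchings (exactly $\alpha n$ edges) on $\{1,\dots,n\}$; the $\ell$-th matching is stage $\ell$, and constraints are streamed stage by stage. In $\mathbf{Y}$, a uniform $z\in\mathbb{Z}_p^n$ is sampled and each edge $(u,v)$ gets constraint $x_u+x_v=z_u+z_v$ (mod $p$); in $\mathbf{N}$, each edge $(u,v)$ gets $x_u+x_v=q$ with $q\in\mathbb{Z}_p$ uniform, independent across edges. The algorithm's output depends only on its final memory. Let $S^Y_i$ and $S^N_i$ be the (random) memory contents in $\{0,1\}^c$ after the constraints of the $i$-th stage have been processed, on inputs from $\mathbf{Y}$ and $\mathbf{N}$ respectively, with $S^Y_0=S^N_0=0$. An index $j\in\{0,\dots,k-1\}$ is $\delta$-informative if $\|S^Y_{j+1}-S^N_{j+1}\|_{tvd}\ge\|S^Y_j-S^N_j\|_{tvd}+\delta$, where $\|\cdot\|_{tvd}$ is total variation distance between the distributions. Distinguishing with advantage $\eta$ means the acceptance probabilities on the two distributions differ by at least $\eta$. -}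

module Defs where

open import Function using (_∘_)
open import Data.Nat as ℕ using (ℕ; zero; suc; NonZero)
open import Data.Nat.DivMod using (_mod_)
open import Data.Fin as Fin using (Fin; toℕ)
open import Data.Fin.Properties using () renaming (_≟_ to _≟ᶠ_)
open import Data.Bool using (Bool; true; false; _∧_; not)
open import Data.Product using (_×_; _,_)
open import Data.Vec as Vec using (Vec; []; _∷_)
open import Data.Vec.Properties using () renaming (≡-dec to vec≡-dec)
open import Data.Bool.Properties using () renaming (_≟_ to _≟ᵇ_)
open import Data.List as List using (List; []; _∷_; concatMap; filterᵇ; length; foldr; foldl; take; allFin; concat)
open import Data.Integer using (+_)
open import Data.Rational as ℚ using (ℚ; 0ℚ; _/_; ∣_∣; ½; _≤_)
open import Relation.Nullary.Decidable using (⌊_⌋)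
open import Data.Bool.ListAction using (any)

allVecs : ∀ {A : Set} → List A → (m : ℕ) → List (Vec A m)
allVecs xs zero    = [] ∷ []
allVecs xs (suc m) = concatMap (λ x → List.map (x ∷_) (allVecs xs m)) xs

-- Probability that a uniformly random element of the (multiset) list Ω
-- satisfies the boolean predicate P  (0 if Ω is empty).
prob : ∀ {Ω : Set} → List Ω → (Ω → Bool) → ℚ
prob []       P = 0ℚ
prob (ω ∷ ωs) P = (+ length (filterᵇ P (ω ∷ ωs))) / suc (length ωs)

sumℚ : List ℚ → ℚ
sumℚ = foldr ℚ._+_ 0ℚ

Mem : ℕ → Set
Mem c = Vec Bool c

allMems : (c : ℕ) → List (Mem c)
allMems c = allVecs (true ∷ false ∷ []) c

zeroMem : (c : ℕ) → Mem c
zeroMem c = Vec.replicate c false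

_=ᴹ_ : ∀ {c} → Mem c → Mem c → Bool
s =ᴹ t = ⌊ vec≡-dec _≟ᵇ_ s t ⌋

tvd : ∀ c → (Mem c → ℚ) → (Mem c → ℚ) → ℚ
tvd c P Q = ½ ℚ.* sumℚ (List.map (λ s → ∣ P s ℚ.- Q s ∣) (allMems c))

Edge : ℕ → Set
Edge n = Fin n × Fin n

allEdges : (n : ℕ) → List (Edge n)
allEdges n = concatMap (λ u → List.map (u ,_) (allFin n)) (allFin n)

-- an ordered list of m edges; it is a matching iff all 2m endpoints are distinct
Matching : ℕ → ℕ → Set
Matching n m = Vec (Edge n) m

verts : ∀ {n m} → Matching n m → List (Fin n)
verts []            = []
verts ((u , v) ∷ M) = u ∷ v ∷ verts M

noDup : ∀ {n} → List (Fin n) → Bool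
noDup []       = true
noDup (x ∷ xs) = not (any (λ y → ⌊ x ≟ᶠ y ⌋) xs) ∧ noDup xs

-- all partial matchings with exactly m edges (edges ordered and oriented;
-- uniform over this list induces the uniform m-edge matching)
matchings : (n m : ℕ) → List (Matching n m)
matchings n m = filterᵇ (noDup ∘ verts) (allVecs (allEdges n) m)

addMod : (p : ℕ) → .{{NonZero p}} → Fin p → Fin p → Fin p
addMod p a b = (toℕ a ℕ.+ toℕ b) mod p

-- constraint (u , v , b) means  x_u + x_v = b (mod p)
Constraint : ℕ → ℕ → Set
Constraint p n = Fin n × Fin n × Fin p

-- The Y and N distributions (k stages, m = αn edges per stage)

YSample : ℕ → ℕ → ℕ → ℕ → Set
YSample p n m k = Vec (Matching n m) k × Vec (Fin p) n

ySpace : (p n m k : ℕ) → List (YSample p n m k)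
ySpace p n m k =
  concatMap (λ Ms → List.map (Ms ,_) (allVecs (allFin p) n)) (allVecs (matchings n m) k)

yStage : ∀ {p n m} → .{{NonZero p}} → Vec (Fin p) n → Matching n m → List (Constraint p n)
yStage {p} z M =
  Vec.toList (Vec.map (λ { (u , v) → u , v , addMod p (Vec.lookup z u) (Vec.lookup z v) }) M)

yStages : ∀ {p n m k} → .{{NonZero p}} → YSample p n m k → List (List (Constraint p n))
yStages (Ms , z) = Vec.toList (Vec.map (yStage z) Ms)

NSample : ℕ → ℕ → ℕ → ℕ → Set
NSample p n m k = Vec (Matching n m × Vec (Fin p) m) k

nSpace : (p n m k : ℕ) → List (NSample p n m k)
nSpace p n m k =
  allVecs (concatMap (λ M → List.map (M ,_) (allVecs (allFin p) m)) (matchings n m)) k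

nStage : ∀ {p n m} → Matching n m × Vec (Fin p) m → List (Constraint p n)
nStage (M , qs) = Vec.toList (Vec.zipWith (λ { (u , v) q → u , v , q }) M qs)

nStages : ∀ {p n m k} → NSample p n m k → List (List (Constraint p n))
nStages Ns = Vec.toList (Vec.map nStage Ns)

record StreamAlg (p n c : ℕ) : Set where
  field
    update : Constraint p n → Mem c → Mem c
    output : Mem c → Bool     -- true = accept; depends only on final memory

open StreamAlg public

memAfter : ∀ {p n c} → StreamAlg p n c → ℕ → List (List (Constraint p n)) → Mem c
memAfter {c = c} A i stages = foldl (λ s e → update A e s) (zeroMem c) (concat (take i stages))

module _ (p n m k c : ℕ) .{{_ : NonZero p}} (A : StreamAlg p n c) where

  SY : ℕ → Mem c → ℚ
  SY i s = prob (ySpace p n m k) (λ ω → memAfter A i (yStages ω) =ᴹ s)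

  SN : ℕ → Mem c → ℚ
  SN i s = prob (nSpace p n m k) (λ ω → memAfter A i (nStages ω) =ᴹ s)

  tvdAt : ℕ → ℚ
  tvdAt i = tvd c (SY i) (SN i)

  advantage : ℚ
  advantage = ∣ prob (ySpace p n m k) (λ ω → output A (memAfter A k (yStages ω)))
                ℚ.- prob (nSpace p n m k) (λ ω → output A (memAfter A k (nStages ω))) ∣

  Informative : ℕ → ℚ → Set
  Informative j δ = tvdAt j ℚ.+ δ ≤ tvdAt (suc j)

module Submission where

-- The argument is a telescoping one.  Write T i for the total variation
-- distance between the memory contents S^Y_i and S^N_i.
--   * T 0 = 0: before any constraint is read both memories are the point
--     mass at 0^c (the two sample spaces are empty or non-empty together).
--   * 1/8 ≤ T k: the output is a function of the final memory, and for any
--     two distributions of a random variable X and any test o,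
--     |Pr[o X] - Pr'[o X]| ≤ Σ_s |Pr[X = s] - Pr'[X = s]| = 2 · tvd.
--   * If no index is δ-informative then T k ≤ T 0 + k·δ, so δ = (1/16)/k
--     would give 1/8 ≤ 1/16.
-- The hypothesis p ≥ 2 is only used to know that Z_p is non-empty.

open import Defs
open import Data.Nat using (ℕ; NonZero) renaming (_≤_ to _≤ℕ_)
open import Data.Fin using (Fin; toℕ)
open import Data.Product using (Σ; ∃; _×_)
open import Data.Integer using (+_)
open import Data.Rational using (ℚ; _/_; _<_; _≤_; _*_; 0ℚ)

open import Function using (_∘_; id)
open import Data.Nat as ℕ using (zero; suc)
open import Data.Fin using (fromℕ; inject₁)
open import Data.Fin.Properties using (toℕ-fromℕ; toℕ-inject₁)
open import Data.Integer as ℤ using ()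
import Data.Integer.Properties as ℤP
open import Data.Integer.Tactic.RingSolver using (solve-∀)
open import Data.Rational using (1ℚ; ½; _+_; _-_; -_; ∣_∣; toℚᵘ)
open import Data.Rational.Properties
open import Data.Rational.Unnormalised as ℚᵘ using (mkℚᵘ; *≡*)
import Data.Rational.Unnormalised.Properties as ℚᵘP
open import Algebra.Bundles using (CommutativeMonoid; CommutativeRing)
open import Algebra.Properties.CommutativeSemigroup
  (CommutativeMonoid.commutativeSemigroup +-0-commutativeMonoid) using (interchange)
open import Algebra.Properties.Semiring.Mult
  (CommutativeRing.semiring +-*-commutativeRing) using (×-comm-*) renaming (_×_ to _·ℕ_)
open import Data.Bool using (Bool; true; false; if_then_else_; _∧_)
open import Data.Bool.Properties using (if-swap-then; if-cong)
  renaming (_≟_ to _≟ᵇ_)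
open import Data.Vec using ([]; _∷_)
open import Data.Vec.Properties using () renaming (≡-dec to vec≡-dec)
open import Data.List as List using (List; []; _∷_; _++_; length; filterᵇ; concatMap; null; allFin)
open import Data.List.Properties using (filter-all; filter-none)
open import Data.List.Relation.Unary.All using (universal)
open import Data.Product using (_,_)
open import Data.Sum using (_⊎_; inj₁; inj₂; [_,_]′)
open import Data.Empty using (⊥-elim)
open import Data.Unit using (tt)
open import Relation.Nullary using (does; yes; no)
open import Relation.Nullary.Decidable using (isYes≗does; toWitness; T?)
open import Relation.Binary.PropositionalEquality

private
  variable
    A B : Set

/-+ : ∀ a b d → + a / suc d + + b / suc d ≡ + (a ℕ.+ b) / suc d
/-+ a b d = toℚᵘ-injective (begin
    toℚᵘ (+ a / suc d + + b / suc d)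
      ≈⟨ toℚᵘ-homo-+ (+ a / suc d) (+ b / suc d) ⟩
    toℚᵘ (+ a / suc d) ℚᵘ.+ toℚᵘ (+ b / suc d)
      ≈⟨ ℚᵘP.+-cong (toℚᵘ-fromℚᵘ (mkℚᵘ (+ a) d)) (toℚᵘ-fromℚᵘ (mkℚᵘ (+ b) d)) ⟩
    mkℚᵘ (+ a) d ℚᵘ.+ mkℚᵘ (+ b) d
      ≈⟨ *≡* (same-denominator (+ a) (+ b) (+ suc d)) ⟩
    mkℚᵘ (+ (a ℕ.+ b)) d
      ≈⟨ toℚᵘ-fromℚᵘ (mkℚᵘ (+ (a ℕ.+ b)) d) ⟨
    toℚᵘ (+ (a ℕ.+ b) / suc d) ∎)
  where
  open ℚᵘP.≃-Reasoning
  same-denominator : ∀ x y D → (x ℤ.* D ℤ.+ y ℤ.* D) ℤ.* D ≡ (x ℤ.+ y) ℤ.* (D ℤ.* D)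
  same-denominator = solve-∀

n/n≡1 : ∀ n → + suc n / suc n ≡ 1ℚ
n/n≡1 n = toℚᵘ-injective
  (ℚᵘP.≃-trans (toℚᵘ-fromℚᵘ (mkℚᵘ (+ suc n) n)) (*≡* (ℤP.*-comm (+ suc n) (+ 1))))

×-/ : ∀ n d → n ·ℕ (+ 1 / suc d) ≡ + n / suc d
×-/ zero    d = sym (0/n≡0 (suc d))
×-/ (suc n) d = trans (cong (_+_ (+ 1 / suc d)) (×-/ n d)) (/-+ 1 n d)

shares-sum : ∀ k x → suc k ·ℕ (x * (+ 1 / suc k)) ≡ x
shares-sum k x = begin
  suc k ·ℕ (x * (+ 1 / suc k))  ≡⟨ ×-comm-* (suc k) x (+ 1 / suc k) ⟨
  x * (suc k ·ℕ (+ 1 / suc k))  ≡⟨ cong (x *_) (trans (×-/ (suc k) k) (n/n≡1 k)) ⟩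
  x * 1ℚ                       ≡⟨ *-identityʳ x ⟩
  x                            ∎
  where open ≡-Reasoning

∑ : List A → (A → ℚ) → ℚ
∑ xs f = sumℚ (List.map f xs)

∑-cong : ∀ (xs : List A) {f g : A → ℚ} → (∀ a → f a ≡ g a) → ∑ xs f ≡ ∑ xs g
∑-cong []       e = refl
∑-cong (x ∷ xs) e = cong₂ _+_ (e x) (∑-cong xs e)

∑-zero : ∀ (xs : List A) → ∑ xs (λ _ → 0ℚ) ≡ 0ℚ
∑-zero []       = refl
∑-zero (x ∷ xs) = trans (+-identityˡ _) (∑-zero xs)

∑-++ : ∀ (xs ys : List A) f → ∑ (xs ++ ys) f ≡ ∑ xs f + ∑ ys f
∑-++ []       ys f = sym (+-identityˡ _)
∑-++ (x ∷ xs) ys f = trans (cong (_+_ (f x)) (∑-++ xs ys f)) (sym (+-assoc (f x) _ _))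

∑-map : ∀ (g : A → B) (xs : List A) f → ∑ (List.map g xs) f ≡ ∑ xs (f ∘ g)
∑-map g []       f = refl
∑-map g (x ∷ xs) f = cong (_+_ (f (g x))) (∑-map g xs f)

∑-+ : ∀ (xs : List A) f g → ∑ xs (λ a → f a + g a) ≡ ∑ xs f + ∑ xs g
∑-+ []       f g = sym (+-identityʳ 0ℚ)
∑-+ (x ∷ xs) f g =
  trans (cong (_+_ (f x + g x)) (∑-+ xs f g)) (interchange (f x) (g x) (∑ xs f) (∑ xs g))

∑-sub : ∀ (xs : List A) f g → ∑ xs (λ a → f a - g a) ≡ ∑ xs f - ∑ xs g
∑-sub []       f g = refl
∑-sub (x ∷ xs) f g = begin
  (f x - g x) + ∑ xs (λ a → f a - g a)  ≡⟨ cong (_+_ (f x - g x)) (∑-sub xs f g) ⟩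
  (f x - g x) + (∑ xs f - ∑ xs g)       ≡⟨ interchange (f x) (- g x) (∑ xs f) (- ∑ xs g) ⟩
  (f x + ∑ xs f) + (- g x - ∑ xs g)     ≡⟨ cong (_+_ (f x + ∑ xs f)) (neg-distrib-+ (g x) (∑ xs g)) ⟨
  (f x + ∑ xs f) - (g x + ∑ xs g)       ∎
  where open ≡-Reasoning

∑-swap : ∀ (xs : List A) (ys : List B) (F : A → B → ℚ) →
  ∑ xs (λ a → ∑ ys (F a)) ≡ ∑ ys (λ b → ∑ xs (λ a → F a b))
∑-swap []       ys F = sym (∑-zero ys)
∑-swap (x ∷ xs) ys F =
  trans (cong (_+_ (∑ ys (F x))) (∑-swap xs ys F)) (sym (∑-+ ys (F x) (λ b → ∑ xs (λ a → F a b))))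

∑-if : ∀ (xs : List A) b f → ∑ xs (λ a → if b then f a else 0ℚ) ≡ (if b then ∑ xs f else 0ℚ)
∑-if xs true  f = refl
∑-if xs false f = ∑-zero xs

∑-mono : ∀ (xs : List A) {f g : A → ℚ} → (∀ a → f a ≤ g a) → ∑ xs f ≤ ∑ xs g
∑-mono []       e = ≤-refl
∑-mono (x ∷ xs) e = +-mono-≤ (e x) (∑-mono xs e)

∑-abs : ∀ (xs : List A) f → ∣ ∑ xs f ∣ ≤ ∑ xs (∣_∣ ∘ f)
∑-abs []       f = ≤-refl
∑-abs (x ∷ xs) f = ≤-trans (∣p+q∣≤∣p∣+∣q∣ (f x) (∑ xs f)) (+-monoʳ-≤ ∣ f x ∣ (∑-abs xs f))

=ᴹ-∷ : ∀ {c} b b' (x s : Mem c) → (b ∷ x) =ᴹ (b' ∷ s) ≡ does (b ≟ᵇ b') ∧ x =ᴹ s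
=ᴹ-∷ b b' x s = trans (isYes≗does (vec≡-dec _≟ᵇ_ (b ∷ x) (b' ∷ s)))
                      (cong (does (b ≟ᵇ b') ∧_) (sym (isYes≗does (vec≡-dec _≟ᵇ_ x s))))

∑-allMems-suc : ∀ c (h : Mem (suc c) → ℚ) →
  ∑ (allMems (suc c)) h ≡ ∑ (allMems c) (h ∘ (true ∷_)) + ∑ (allMems c) (h ∘ (false ∷_))
∑-allMems-suc c h = begin
  ∑ (List.map (true ∷_) M ++ List.map (false ∷_) M ++ []) h
    ≡⟨ ∑-++ (List.map (true ∷_) M) _ h ⟩
  ∑ (List.map (true ∷_) M) h + ∑ (List.map (false ∷_) M ++ []) h
    ≡⟨ cong₂ _+_ (∑-map (true ∷_) M h)
                 (trans (∑-++ (List.map (false ∷_) M) [] h) (+-identityʳ _)) ⟩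
  ∑ M (h ∘ (true ∷_)) + ∑ (List.map (false ∷_) M) h
    ≡⟨ cong (_+_ (∑ M (h ∘ (true ∷_)))) (∑-map (false ∷_) M h) ⟩
  ∑ M (h ∘ (true ∷_)) + ∑ M (h ∘ (false ∷_)) ∎
  where
  open ≡-Reasoning
  M : List (Mem c)
  M = allMems c

∑-head : ∀ c b b' (x : Mem c) (g : Mem c → ℚ) →
  ∑ (allMems c) (λ s → if (b ∷ x) =ᴹ (b' ∷ s) then g s else 0ℚ)
    ≡ ∑ (allMems c) (λ s → if does (b ≟ᵇ b') ∧ x =ᴹ s then g s else 0ℚ)
∑-head c b b' x g = ∑-cong (allMems c) (λ s → if-cong (=ᴹ-∷ b b' x s))

-- Every memory state occurs exactly once in allMems: summing a function
-- against the indicator of the state x picks out its value at x.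
∑-point : ∀ c (x : Mem c) (g : Mem c → ℚ) → ∑ (allMems c) (λ s → if x =ᴹ s then g s else 0ℚ) ≡ g x
∑-point zero    []        g = +-identityʳ (g [])
∑-point (suc c) (true ∷ x) g = begin
  ∑ (allMems (suc c)) _                                   ≡⟨ ∑-allMems-suc c _ ⟩
  ∑ M (λ s → if (true ∷ x) =ᴹ (true ∷ s) then g (true ∷ s) else 0ℚ)
    + ∑ M (λ s → if (true ∷ x) =ᴹ (false ∷ s) then g (false ∷ s) else 0ℚ)
    ≡⟨ cong₂ _+_ (trans (∑-head c true true x (g ∘ (true ∷_))) (∑-point c x (g ∘ (true ∷_))))
                 (trans (∑-head c true false x (g ∘ (false ∷_))) (∑-zero M)) ⟩
  g (true ∷ x) + 0ℚ                                       ≡⟨ +-identityʳ _ ⟩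
  g (true ∷ x)                                            ∎
  where
  open ≡-Reasoning
  M : List (Mem c)
  M = allMems c
∑-point (suc c) (false ∷ x) g = begin
  ∑ (allMems (suc c)) _                                   ≡⟨ ∑-allMems-suc c _ ⟩
  ∑ M (λ s → if (false ∷ x) =ᴹ (true ∷ s) then g (true ∷ s) else 0ℚ)
    + ∑ M (λ s → if (false ∷ x) =ᴹ (false ∷ s) then g (false ∷ s) else 0ℚ)
    ≡⟨ cong₂ _+_ (trans (∑-head c false true x (g ∘ (true ∷_))) (∑-zero M))
                 (trans (∑-head c false false x (g ∘ (false ∷_))) (∑-point c x (g ∘ (false ∷_)))) ⟩
  0ℚ + g (false ∷ x)                                      ≡⟨ +-identityˡ _ ⟩
  g (false ∷ x)                                           ∎
  where
  open ≡-Reasoning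
  M : List (Mem c)
  M = allMems c

mass : List A → ℚ
mass []       = 0ℚ
mass (x ∷ xs) = + 1 / suc (length xs)

∑-count : ∀ (xs : List A) (P : A → Bool) d →
  ∑ xs (λ a → if P a then + 1 / suc d else 0ℚ) ≡ + length (filterᵇ P xs) / suc d
∑-count []       P d = sym (0/n≡0 (suc d))
∑-count (x ∷ xs) P d with P x
... | true  = trans (cong (_+_ (+ 1 / suc d)) (∑-count xs P d)) (/-+ 1 (length (filterᵇ P xs)) d)
... | false = trans (+-identityˡ _) (∑-count xs P d)

prob-as-sum : ∀ (Ω : List A) P → prob Ω P ≡ ∑ Ω (λ a → if P a then mass Ω else 0ℚ)
prob-as-sum []       P = refl
prob-as-sum (x ∷ xs) P = sym (∑-count (x ∷ xs) P (length xs))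

prob-const : ∀ (Ω : List A) b → prob Ω (λ _ → b) ≡ (if null Ω then 0ℚ else if b then 1ℚ else 0ℚ)
prob-const []       b     = refl
prob-const (x ∷ xs) true  =
  trans (cong (λ ys → + length ys / suc (length xs))
              (filter-all (T? ∘ λ _ → true) (universal (λ _ → tt) (x ∷ xs))))
        (n/n≡1 (length xs))
prob-const (x ∷ xs) false =
  trans (cong (λ ys → + length ys / suc (length xs))
              (filter-none (T? ∘ λ _ → false) (universal (λ _ ()) (x ∷ xs))))
        (0/n≡0 (suc (length xs)))

law : ∀ {c} → List A → (A → Mem c) → Mem c → ℚ
law Ω f s = prob Ω (λ a → f a =ᴹ s)

prob-via-law : ∀ c (Ω : List A) (f : A → Mem c) (o : Mem c → Bool) →
  prob Ω (o ∘ f) ≡ ∑ (allMems c) (λ s → if o s then law Ω f s else 0ℚ)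
prob-via-law c Ω f o = begin
  prob Ω (o ∘ f)
    ≡⟨ prob-as-sum Ω (o ∘ f) ⟩
  ∑ Ω (λ a → if o (f a) then w else 0ℚ)
    ≡⟨ ∑-cong Ω (λ a → ∑-point c (f a) (λ s → if o s then w else 0ℚ)) ⟨
  ∑ Ω (λ a → ∑ M (λ s → if f a =ᴹ s then (if o s then w else 0ℚ) else 0ℚ))
    ≡⟨ ∑-swap Ω M _ ⟩
  ∑ M (λ s → ∑ Ω (λ a → if f a =ᴹ s then (if o s then w else 0ℚ) else 0ℚ))
    ≡⟨ ∑-cong M (λ s → ∑-cong Ω (λ a → if-swap-then (f a =ᴹ s) (o s))) ⟩
  ∑ M (λ s → ∑ Ω (λ a → if o s then (if f a =ᴹ s then w else 0ℚ) else 0ℚ))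
    ≡⟨ ∑-cong M (λ s → trans (∑-if Ω (o s) _) (cong (λ t → if o s then t else 0ℚ)
                                                     (sym (prob-as-sum Ω (λ a → f a =ᴹ s))))) ⟩
  ∑ M (λ s → if o s then law Ω f s else 0ℚ) ∎
  where
  open ≡-Reasoning
  w : ℚ
  w = mass Ω
  M : List (Mem c)
  M = allMems c

½advantage≤tvd : ∀ c (ΩY : List A) (ΩN : List B) (fY : A → Mem c) (fN : B → Mem c) (o : Mem c → Bool) →
  ½ * ∣ prob ΩY (o ∘ fY) - prob ΩN (o ∘ fN) ∣ ≤ tvd c (law ΩY fY) (law ΩN fN)
½advantage≤tvd c ΩY ΩN fY fN o = *-monoˡ-≤-nonNeg ½ (begin
  ∣ prob ΩY (o ∘ fY) - prob ΩN (o ∘ fN) ∣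
    ≡⟨ cong ∣_∣ (cong₂ _-_ (prob-via-law c ΩY fY o) (prob-via-law c ΩN fN o)) ⟩
  ∣ ∑ M (guarded (law ΩY fY)) - ∑ M (guarded (law ΩN fN)) ∣
    ≡⟨ cong ∣_∣ (∑-sub M (guarded (law ΩY fY)) (guarded (law ΩN fN))) ⟨
  ∣ ∑ M (λ s → guarded (law ΩY fY) s - guarded (law ΩN fN) s) ∣
    ≤⟨ ∑-abs M _ ⟩
  ∑ M (λ s → ∣ guarded (law ΩY fY) s - guarded (law ΩN fN) s ∣)
    ≤⟨ ∑-mono M guarded-dist ⟩
  ∑ M (λ s → ∣ law ΩY fY s - law ΩN fN s ∣) ∎)
  where
  open ≤-Reasoning
  M : List (Mem c)
  M = allMems c
  guarded : (Mem c → ℚ) → Mem c → ℚ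
  guarded P s = if o s then P s else 0ℚ
  guarded-dist : ∀ s → ∣ guarded (law ΩY fY) s - guarded (law ΩN fN) s ∣ ≤ ∣ law ΩY fY s - law ΩN fN s ∣
  guarded-dist s with o s
  ... | true  = ≤-refl
  ... | false = 0≤∣p∣ _

tvd-const : ∀ c (x : Mem c) (ΩY : List A) (ΩN : List B) → null ΩY ≡ null ΩN →
  tvd c (law ΩY (λ _ → x)) (law ΩN (λ _ → x)) ≡ 0ℚ
tvd-const c x ΩY ΩN same-null = begin
  ½ * ∑ M (λ s → ∣ prob ΩY (λ _ → x =ᴹ s) - prob ΩN (λ _ → x =ᴹ s) ∣)
    ≡⟨ cong (½ *_) (∑-cong M (λ s → cong ∣_∣ (difference-zero (x =ᴹ s)))) ⟩
  ½ * ∑ M (λ _ → 0ℚ)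
    ≡⟨ cong (½ *_) (∑-zero M) ⟩
  ½ * 0ℚ
    ≡⟨ *-zeroʳ ½ ⟩
  0ℚ ∎
  where
  open ≡-Reasoning
  M : List (Mem c)
  M = allMems c
  difference-zero : ∀ b → prob ΩY (λ _ → b) - prob ΩN (λ _ → b) ≡ 0ℚ
  difference-zero b = begin
    prob ΩY (λ _ → b) - prob ΩN (λ _ → b)
      ≡⟨ cong (_- prob ΩN (λ _ → b)) (prob-const ΩY b) ⟩
    (if null ΩY then 0ℚ else if b then 1ℚ else 0ℚ) - prob ΩN (λ _ → b)
      ≡⟨ cong (λ e → (if e then 0ℚ else if b then 1ℚ else 0ℚ) - prob ΩN (λ _ → b)) same-null ⟩
    (if null ΩN then 0ℚ else if b then 1ℚ else 0ℚ) - prob ΩN (λ _ → b)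
      ≡⟨ cong (_- prob ΩN (λ _ → b)) (prob-const ΩN b) ⟨
    prob ΩN (λ _ → b) - prob ΩN (λ _ → b)
      ≡⟨ +-inverseʳ (prob ΩN (λ _ → b)) ⟩
    0ℚ ∎

Jump : (ℕ → ℚ) → ℚ → ℕ → Set
Jump T δ j = T j + δ ≤ T (suc j)

telescope : ∀ (T : ℕ → ℚ) δ k → (∃ λ (j : Fin k) → Jump T δ (toℕ j)) ⊎ (T k ≤ T 0 + k ·ℕ δ)
telescope T δ zero = inj₂ (≤-reflexive (sym (+-identityʳ (T 0))))
telescope T δ (suc k) with telescope T δ k
... | inj₁ (j , jump) = inj₁ (inject₁ j , subst (Jump T δ) (sym (toℕ-inject₁ j)) jump)
... | inj₂ bound with T k + δ ≤? T (suc k)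
...   | yes jump = inj₁ (fromℕ k , subst (Jump T δ) (sym (toℕ-fromℕ k)) jump)
...   | no ¬jump = inj₂ (begin
  T (suc k)            ≤⟨ <⇒≤ (≰⇒> ¬jump) ⟩
  T k + δ              ≤⟨ +-monoˡ-≤ δ bound ⟩
  T 0 + k ·ℕ δ + δ     ≡⟨ +-assoc (T 0) (k ·ℕ δ) δ ⟩
  T 0 + (k ·ℕ δ + δ)   ≡⟨ cong (_+_ (T 0)) (+-comm (k ·ℕ δ) δ) ⟩
  T 0 + suc k ·ℕ δ     ∎)
  where open ≤-Reasoning

null-++ : ∀ (xs ys : List A) → null (xs ++ ys) ≡ null xs ∧ null ys
null-++ []       ys = refl
null-++ (x ∷ xs) ys = refl

null-map : ∀ (f : A → B) xs → null (List.map f xs) ≡ null xs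
null-map f []       = refl
null-map f (x ∷ xs) = refl

null-concatMap : ∀ {f : A → List B} → (∀ x → null (f x) ≡ false) → ∀ xs → null (concatMap f xs) ≡ null xs
null-concatMap nonempty []       = refl
null-concatMap nonempty (x ∷ xs) = trans (null-++ _ (concatMap _ xs)) (cong (_∧ _) (nonempty x))

null-allVecs : ∀ (xs : List A) m → null (allVecs xs (suc m)) ≡ null xs
allVecs-nonempty : ∀ (xs : List A) → null xs ≡ false → ∀ m → null (allVecs xs m) ≡ false

null-allVecs []       m = refl
null-allVecs (y ∷ ys) m =
  null-concatMap (λ x → trans (null-map (x ∷_) _) (allVecs-nonempty (y ∷ ys) refl m)) (y ∷ ys)

allVecs-nonempty xs nonempty zero    = refl
allVecs-nonempty xs nonempty (suc m) = trans (null-allVecs xs m) nonempty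

null-ySpace : ∀ p n m k → null (ySpace (suc p) n m (suc k)) ≡ null (matchings n m)
null-ySpace p n m k = trans
  (null-concatMap (λ Ms → trans (null-map (Ms ,_) _) (allVecs-nonempty (allFin (suc p)) refl n)) _)
  (null-allVecs (matchings n m) k)

null-nSpace : ∀ p n m k → null (nSpace (suc p) n m (suc k)) ≡ null (matchings n m)
null-nSpace p n m k = trans
  (null-allVecs _ k)
  (null-concatMap (λ M → trans (null-map (M ,_) _) (allVecs-nonempty (allFin (suc p)) refl m)) (matchings n m))

C : ℚ
C = + 1 / 16

C-pos : 0ℚ < C
C-pos = toWitness {a? = 0ℚ <? C} tt

C<½·¼ : C < ½ * (+ 1 / 4)
C<½·¼ = toWitness {a? = C <? ½ * (+ 1 / 4)} tt

informative-index : (p n m k c : ℕ) → .{{_ : NonZero p}} → .{{_ : NonZero k}} → 2 ≤ℕ p →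
  (A : StreamAlg p n c) →
  + 1 / 4 ≤ advantage p n m k c A →
  ∃ λ (j : Fin k) → Informative p n m k c A (toℕ j) (C * (+ 1 / k))
informative-index p       n m zero    c _  A _ = ⊥-elim (ℕ.≢-nonZero⁻¹ zero refl)
informative-index zero    n m (suc k) c () A _
informative-index (suc p) n m (suc k) c _  A quarter≤adv =
  [ id , (λ bound → ⊥-elim (<-irrefl refl (C<C bound))) ]′ (telescope T δ (suc k))
  where
  open ≤-Reasoning
  ΩY : List (YSample (suc p) n m (suc k))
  ΩY = ySpace (suc p) n m (suc k)
  ΩN : List (NSample (suc p) n m (suc k))
  ΩN = nSpace (suc p) n m (suc k)
  T : ℕ → ℚ
  T = tvdAt (suc p) n m (suc k) c A
  δ : ℚ
  δ = C * (+ 1 / suc k)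
  final : ∀ {Ω : Set} → (Ω → List (List (Constraint (suc p) n))) → Ω → Mem c
  final stages ω = memAfter A (suc k) (stages ω)
  T0≡0 : T 0 ≡ 0ℚ
  T0≡0 = tvd-const c (zeroMem c) ΩY ΩN
           (trans (null-ySpace p n m k) (sym (null-nSpace p n m k)))
  -- Without a δ-jump the final distance would be at most C < 1/8.
  C<C : T (suc k) ≤ T 0 + suc k ·ℕ δ → C < C
  C<C bound = begin-strict
    C                                      <⟨ C<½·¼ ⟩
    ½ * (+ 1 / 4)                          ≤⟨ *-monoˡ-≤-nonNeg ½ quarter≤adv ⟩
    ½ * advantage (suc p) n m (suc k) c A  ≤⟨ ½advantage≤tvd c ΩY ΩN (final yStages) (final nStages) (output A) ⟩
    T (suc k)                              ≤⟨ bound ⟩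
    T 0 + suc k ·ℕ δ                       ≡⟨ cong (_+ suc k ·ℕ δ) T0≡0 ⟩
    0ℚ + suc k ·ℕ δ                        ≡⟨ +-identityˡ (suc k ·ℕ δ) ⟩
    suc k ·ℕ δ                             ≡⟨ shares-sum k C ⟩
    C                                      ∎

lemma4p5 : Σ ℚ λ C → 0ℚ < C ×
    ((p n m k c : ℕ) → .{{_ : NonZero p}} → .{{_ : NonZero k}} → 2 ≤ℕ p →
      (A : StreamAlg p n c) →
      + 1 / 4 ≤ advantage p n m k c A →
      ∃ λ (j : Fin k) → Informative p n m k c A (toℕ j) (C * (+ 1 / k)))
lemma4p5 = C , C-pos , informative-index
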